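{- Let $P,Q$ be posets. The duality map $D:\mathrm{Pro}(P,Q)\to\mathrm{Pro}(Q,P)$ is a homeomorphism, where both spaces carry the topology generated by the intervals $U(g,h)$ with $g$ small and $h$ large.
   Context: $\widehat{Q}$ is the set of down-sets of $Q$ ordered by inclusion. A profunctor $f:P\to Q$ is an order-preserving map $f:P\to\widehat{Q}$; $\mathrm{Pro}(P,Q)$ is ordered pointwise by inclusion. $Df(q)=\{p\in P: q\notin f(p)\}$. $f$ is large if $\{p: f(p)\neq Q\}$ is finite, small if $\bigcup_p f(p)$ is finite. The topology on $\mathrm{Pro}(P,Q)$ has as basis the sets $U(g,h)=\{f: g\le f\le h\}$ with $g$ small and $h$ large. -}

module Defs where

open import Level using (Level; _⊔_)
open import Data.Bool using (Bool; true; false; not)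
open import Data.List using (List)
open import Data.List.Relation.Unary.Any using (Any)
open import Data.Product using (Σ; ∃; _×_; _,_)
open import Relation.Binary.Bundles using (Poset)
open import Relation.Binary.PropositionalEquality using (_≡_; refl)

Finite : ∀ {c ℓ₁ ℓ₂ ℓ} (P : Poset c ℓ₁ ℓ₂) → (Poset.Carrier P → Set ℓ) → Set (c ⊔ ℓ₁ ⊔ ℓ)
Finite P S = Σ (List (Poset.Carrier P)) λ xs → ∀ x → S x → Any (Poset._≈_ P x) xs

not-contra : ∀ {a b : Bool} → (a ≡ true → b ≡ true) → not b ≡ true → not a ≡ true
not-contra {false} {_} h nb = refl
not-contra {true} {true} h ()
not-contra {true} {false} h nb with h refl
... | ()

module _ {c₁ ℓ₁ ℓ₂ c₂ ℓ₃ ℓ₄} (P : Poset c₁ ℓ₁ ℓ₂) (Q : Poset c₂ ℓ₃ ℓ₄) where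
  private
    module P = Poset P
    module Q = Poset Q

  -- A profunctor P → Q: an order-preserving map P → Q̂, where a down-set of Q
  -- is represented by its (Bool-valued) characteristic function.
  -- rel p q ≡ true  means  q ∈ f(p).
  record Pro : Set (c₁ ⊔ c₂ ⊔ ℓ₂ ⊔ ℓ₄) where
    field
      rel  : P.Carrier → Q.Carrier → Bool
      down : ∀ {p q q′} → q′ Q.≤ q → rel p q ≡ true → rel p q′ ≡ true
      mono : ∀ {p p′ q} → p P.≤ p′ → rel p q ≡ true → rel p′ q ≡ true
  open Pro public

  _⊑_ : Pro → Pro → Set (c₁ ⊔ c₂)
  f ⊑ g = ∀ p q → rel f p q ≡ true → rel g p q ≡ true

  _≐_ : Pro → Pro → Set (c₁ ⊔ c₂)
  f ≐ g = ∀ p q → rel f p q ≡ rel g p q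

  Small : Pro → Set (c₁ ⊔ c₂ ⊔ ℓ₃)
  Small f = Finite Q (λ q → ∃ λ p → rel f p q ≡ true)

  Large : Pro → Set (c₁ ⊔ c₂ ⊔ ℓ₁)
  Large f = Finite P (λ p → ∃ λ q → rel f p q ≡ false)

  U : Pro → Pro → Pro → Set (c₁ ⊔ c₂)
  U g h f = (g ⊑ f) × (f ⊑ h)

  -- open sets of the topology with basis {U(g,h) : g small, h large}:
  -- unions of basic sets
  IsOpen : ∀ {ℓ} → (Pro → Set ℓ) → Set (c₁ ⊔ c₂ ⊔ ℓ₁ ⊔ ℓ₂ ⊔ ℓ₃ ⊔ ℓ₄ ⊔ ℓ)
  IsOpen W = ∀ f → W f →
    Σ Pro λ g → Σ Pro λ h → Small g × Large h × U g h f × (∀ k → U g h k → W k)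

D : ∀ {c₁ ℓ₁ ℓ₂ c₂ ℓ₃ ℓ₄} (P : Poset c₁ ℓ₁ ℓ₂) (Q : Poset c₂ ℓ₃ ℓ₄) → Pro P Q → Pro Q P
D P Q f = record
  { rel  = λ q p → not (rel f p q)
  ; down = λ p′≤p → not-contra (mono f p′≤p)
  ; mono = λ q′≤q → not-contra (down f q′≤q)
  }

Continuous : ∀ {a₁ b₁ c₁ a₂ b₂ c₂ a₃ b₃ c₃ a₄ b₄ c₄}
  {P : Poset a₁ b₁ c₁} {Q : Poset a₂ b₂ c₂}
  {P′ : Poset a₃ b₃ c₃} {Q′ : Poset a₄ b₄ c₄} →
  ∀ ℓ → (Pro P Q → Pro P′ Q′) → Set _
Continuous {P = P} {Q} {P′} {Q′} ℓ F =
  (W : Pro P′ Q′ → Set ℓ) → IsOpen P′ Q′ W → IsOpen P Q (λ f → W (F f))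

IsHomeomorphism : ∀ {a₁ b₁ c₁ a₂ b₂ c₂ a₃ b₃ c₃ a₄ b₄ c₄}
  {P : Poset a₁ b₁ c₁} {Q : Poset a₂ b₂ c₂}
  {P′ : Poset a₃ b₃ c₃} {Q′ : Poset a₄ b₄ c₄} →
  ∀ ℓ → (Pro P Q → Pro P′ Q′) → Set _
IsHomeomorphism {P = P} {Q} {P′} {Q′} ℓ F = Σ (Pro P′ Q′ → Pro P Q) λ G →
    (∀ f → _≐_ P Q (G (F f)) f)
  × (∀ g → _≐_ P′ Q′ (F (G g)) g)
  × Continuous ℓ F
  × Continuous ℓ G

{-# OPTIONS --safe #-}
-- D is an antitone involution on profunctors, hence self-adjoint:
-- f ⊑ Dg iff g ⊑ Df. So D carries the interval U(g,h) exactly onto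
-- U(Dh,Dg). It also swaps small and large: Df(q) is all of P precisely when
-- q lies in no f(p). Hence D maps basic open sets to basic open sets, and
-- being its own inverse it is a homeomorphism.
module Submission where

open import Defs
open import Level using (Level)
open import Relation.Binary.Bundles using (Poset)
open import Data.Bool.Properties using (not-involutive; not-injective)
open import Data.Product using (_,_)
open import Relation.Binary.PropositionalEquality using (sym; trans)

module _ {c₁ ℓ₁ ℓ₂ c₂ ℓ₃ ℓ₄} {P : Poset c₁ ℓ₁ ℓ₂} {Q : Poset c₂ ℓ₃ ℓ₄} where

  D-involutive : ∀ f → _≐_ P Q (D Q P (D P Q f)) f
  D-involutive f p q = not-involutive (rel f p q)

  D-antitone : ∀ f g → _⊑_ P Q f g → _⊑_ Q P (D P Q g) (D P Q f)
  D-antitone f g f⊑g q p = not-contra (f⊑g p q)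

  ⊑D⇒⊑D : ∀ f g → _⊑_ P Q f (D Q P g) → _⊑_ Q P g (D P Q f)
  ⊑D⇒⊑D f g f⊑Dg q p gqp =
    D-antitone f (D Q P g) f⊑Dg q p (trans (not-involutive (rel g q p)) gqp)

  D⊑⇒D⊑ : ∀ f g → _⊑_ P Q (D Q P g) f → _⊑_ Q P (D P Q f) g
  D⊑⇒D⊑ f g Dg⊑f q p Dfqp =
    trans (sym (not-involutive (rel g q p))) (D-antitone (D Q P g) f Dg⊑f q p Dfqp)

  small⇒D-large : ∀ f → Small P Q f → Large Q P (D P Q f)
  small⇒D-large _ (qs , covers) = qs , λ q (p , Dfqp) → covers q (p , not-injective Dfqp)

  large⇒D-small : ∀ f → Large P Q f → Small Q P (D P Q f)
  large⇒D-small _ (ps , covers) = ps , λ p (q , Dfqp) → covers p (q , not-injective Dfqp)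

module _ {c₁ ℓ₁ ℓ₂ c₂ ℓ₃ ℓ₄} {P : Poset c₁ ℓ₁ ℓ₂} {Q : Poset c₂ ℓ₃ ℓ₄} where

  D-U : ∀ g h f → U Q P g h (D P Q f) → U P Q (D Q P h) (D Q P g) f
  D-U g h f (g⊑Df , Df⊑h) = D⊑⇒D⊑ h f Df⊑h , ⊑D⇒⊑D g f g⊑Df

  D-U⁻¹ : ∀ g h f → U P Q (D Q P h) (D Q P g) f → U Q P g h (D P Q f)
  D-U⁻¹ g h f (Dh⊑f , f⊑Dg) = ⊑D⇒⊑D f g f⊑Dg , D⊑⇒D⊑ f h Dh⊑f

D-continuous : ∀ {c₁ ℓ₁ ℓ₂ c₂ ℓ₃ ℓ₄} (ℓ : Level) (P : Poset c₁ ℓ₁ ℓ₂) (Q : Poset c₂ ℓ₃ ℓ₄) →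
  Continuous ℓ (D P Q)
D-continuous ℓ P Q W W-open f Wf
  with g , h , g-small , h-large , Df∈U , U⊆W ← W-open (D P Q f) Wf =
  D Q P h , D Q P g , large⇒D-small h h-large , small⇒D-large g g-small , D-U g h f Df∈U ,
  λ k k∈U → U⊆W (D P Q k) (D-U⁻¹ g h k k∈U)

lemma5p4 : ∀ {c₁ ℓ₁ ℓ₂ c₂ ℓ₃ ℓ₄} (ℓ : Level) (P : Poset c₁ ℓ₁ ℓ₂) (Q : Poset c₂ ℓ₃ ℓ₄) →
    IsHomeomorphism ℓ (D P Q)
lemma5p4 ℓ P Q =
  D Q P , D-involutive , D-involutive , D-continuous ℓ P Q , D-continuous ℓ Q P
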